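{- If a permutation class $\mathcal C$ satisfies $\mathcal C=\mathcal C[\mathcal C]$ (i.e., $\mathcal C$ is closed under inflation), then $\mathcal C$ is unsplittable.
   Context: $\mathcal X[\mathcal Y]$ is the set of all inflations $\sigma[\tau_1,\dots,\tau_k]$ with $\sigma\in\mathcal X$ of size $k$ and $\tau_i\in\mathcal Y$ (each point $\sigma_i$ replaced by an interval order-isomorphic to $\tau_i$). A merge of permutations $\sigma,\tau$ is a permutation whose elements can be partitioned into a set with pattern $\sigma$ and a set with pattern $\tau$; for classes, $\mathcal C\odot\mathcal D$ is the set of merges of an element of $\mathcal C$ with one of $\mathcal D$. A class $\mathcal C$ is splittable if $\mathcal C\subseteq\mathcal C_1\odot\cdots\odot\mathcal C_k$ for finitely many proper subclasses $\mathcal C_i$ of $\mathcal C$; otherwise unsplittable. -}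

module Defs where

open import Data.Nat using (ℕ; suc)
open import Data.Fin using (Fin; _<_; _≤_)
open import Data.Vec using (Vec; _∷_; [])
open import Data.Product using (Σ; ∃; _×_; _,_)
open import Data.Bool using (Bool; true; false)
open import Relation.Binary.PropositionalEquality using (_≡_; _≢_)
open import Relation.Nullary using (¬_)
open import Function.Bundles using (_⇔_)
open import Function.Definitions using (Injective)

-- A permutation of size n: an injective (hence bijective) map Fin n → Fin n,
-- read as the sequence π(0) π(1) … π(n-1).
record Perm : Set where
  constructor perm
  field
    size : ℕ
    fun  : Fin size → Fin size
    inj  : Injective _≡_ _≡_ fun
open Perm public

-- The restriction of π to the set of positions S is order-isomorphic to τ:
-- e lists the positions of S in increasing order, and τ and π∘e have the
-- same relative order.
RestrictIso : (π : Perm) → (Fin (size π) → Set) → Perm → Set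
RestrictIso π S τ =
  Σ (Fin (size τ) → Fin (size π)) λ e →
      (∀ i j → i < j → e i < e j)
    × (∀ p → S p ⇔ ∃ λ j → e j ≡ p)
    × (∀ i j → (fun τ i < fun τ j) ⇔ (fun π (e i) < fun π (e j)))

_≼_ : Perm → Perm → Set
σ ≼ π =
  Σ (Fin (size σ) → Fin (size π)) λ e →
      (∀ i j → i < j → e i < e j)
    × (∀ i j → (fun σ i < fun σ j) ⇔ (fun π (e i) < fun π (e j)))

PSet : Set₁
PSet = Perm → Set

_⊆_ : PSet → PSet → Set
X ⊆ Y = ∀ π → X π → Y π

_≐_ : PSet → PSet → Set
X ≐ Y = (X ⊆ Y) × (Y ⊆ X)

IsClass : PSet → Set
IsClass C = ∀ σ π → σ ≼ π → C π → C σ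

-- Inflation X[Y]: π = σ[τ₁,…,τₖ] with σ ∈ X of size k and each τᵢ ∈ Y.
-- b assigns to each position of π its block (the point σᵢ it replaces);
-- blocks are consecutive intervals of positions (b weakly increasing),
-- points in different blocks compare as the corresponding points of σ
-- (so each block also occupies an interval of values), and the pattern
-- of π on block i is τᵢ ∈ Y.
Inflation : PSet → PSet → PSet
Inflation X Y π =
  Σ Perm λ σ → X σ ×
  Σ (Fin (size π) → Fin (size σ)) λ b →
      (∀ p q → p ≤ q → b p ≤ b q)
    × (∀ p q → b p ≢ b q → (fun π p < fun π q) ⇔ (fun σ (b p) < fun σ (b q)))
    × (∀ i → Σ Perm λ τ → Y τ × RestrictIso π (λ p → b p ≡ i) τ)

-- Merge C ⊙ D: π's positions split into a set with pattern σ ∈ C and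
-- a set (the complement) with pattern τ ∈ D.
_⊙_ : PSet → PSet → PSet
(C ⊙ D) π =
  Σ (Fin (size π) → Bool) λ c →
      (Σ Perm λ σ → C σ × RestrictIso π (λ p → c p ≡ true) σ)
    × (Σ Perm λ τ → D τ × RestrictIso π (λ p → c p ≡ false) τ)

⨀ : ∀ {k} → Vec PSet (suc k) → PSet
⨀ (C ∷ []) = C
⨀ (C ∷ D ∷ Ds) = C ⊙ ⨀ (D ∷ Ds)

ProperSubclass : PSet → PSet → Set
ProperSubclass D C = IsClass D × (D ⊆ C) × (∃ λ π → C π × ¬ D π)

data AllV {A : Set₁} (P : A → Set) : ∀ {k} → Vec A k → Set₁ where
  []  : AllV P []
  _∷_ : ∀ {k x} {xs : Vec A k} → P x → AllV P xs → AllV P (x ∷ xs)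

Splittable : PSet → Set₁
Splittable C =
  Σ ℕ λ k → Σ (Vec PSet (suc k)) λ Cs →
    AllV (λ D → ProperSubclass D C) Cs × (C ⊆ ⨀ Cs)

Unsplittable : PSet → Set₁
Unsplittable C = ¬ Splittable C

-- Pick, for each proper subclass Dᵢ in a purported splitting, a permutation
-- αᵢ ∈ C ∖ Dᵢ, and nest them: Δ = α₁[α₂[⋯[αₖ]⋯]] lies in C because C is
-- closed under inflation.  If α[β] occurs in a merge of σ and ρ, then either
-- every block of the occurrence meets the σ-part, and a transversal shows
-- α ≼ σ, or some block lies entirely in the ρ-part, and that block shows
-- β ≼ ρ.  By induction Δ occurs in no element of D₁ ⊙ ⋯ ⊙ Dₖ, yet Δ ∈ C.
module Submission where

open import Defs
open import Data.Nat as ℕ using (ℕ; suc)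
import Data.Nat.Properties as ℕ
open import Data.Fin using (Fin; _<_; _≤_; _≟_; toℕ; combine; remQuot; quotient)
open import Data.Fin.Properties
  using (<-cmp; <-irrefl; <-asym; ≤-refl; toℕ-combine; combine-monoˡ-<;
         remQuot-combine; combine-remQuot; combine-injective; any?; all?; ¬∀⟶∃¬)
open import Data.Vec using (Vec; _∷_; [])
open import Data.Product using (Σ; ∃; _×_; _,_; proj₁; proj₂; uncurry)
open import Data.Sum using (_⊎_; inj₁; inj₂)
open import Data.Bool using (Bool; true; false)
open import Data.Bool.Properties using (¬-not) renaming (_≟_ to _≟ᵇ_)
open import Data.Empty using (⊥-elim)
open import Relation.Binary.PropositionalEquality
  using (_≡_; _≢_; refl; sym; trans; cong; subst; subst₂)
open import Relation.Binary.Definitions using (tri<; tri≈; tri>)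
open import Relation.Nullary using (¬_; Dec; yes; no)
open import Function.Base using (id; _∘_)
open import Function.Bundles using (_⇔_; mk⇔; Equivalence)
open import Function.Construct.Composition using (_⇔-∘_)
open import Function.Construct.Symmetry using (⇔-sym)

open Equivalence using (to; from)

private
  variable
    m n : ℕ

combine-<-lex : (i k : Fin m) (j l : Fin n) →
                combine i j < combine k l ⇔ (i < k ⊎ (i ≡ k × j < l))
combine-<-lex {m} {n} i k j l = mk⇔ lex unlex
  where
  lex : combine i j < combine k l → i < k ⊎ (i ≡ k × j < l)
  lex lt with <-cmp i k
  ... | tri< i<k _ _ = inj₁ i<k
  ... | tri≈ _ refl _ = inj₂ (refl , ℕ.+-cancelˡ-< (n ℕ.* toℕ i) (toℕ j) (toℕ l)
                          (subst₂ ℕ._<_ (toℕ-combine i j) (toℕ-combine i l) lt))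
  ... | tri> _ _ k<i = ⊥-elim (<-asym lt (combine-monoˡ-< l j k<i))

  unlex : i < k ⊎ (i ≡ k × j < l) → combine i j < combine k l
  unlex (inj₁ i<k)         = combine-monoˡ-< j l i<k
  unlex (inj₂ (refl , j<l)) = subst₂ ℕ._<_ (sym (toℕ-combine i j)) (sym (toℕ-combine i l))
                                (ℕ.+-monoʳ-< (n ℕ.* toℕ i) j<l)

combine-monoʳ-< : (i : Fin m) {j l : Fin n} → j < l → combine i j < combine i l
combine-monoʳ-< i {j} {l} j<l = from (combine-<-lex i i j l) (inj₂ (refl , j<l))

data CombineView {m n : ℕ} : Fin (m ℕ.* n) → Set where
  combined : (i : Fin m) (j : Fin n) → CombineView (combine i j)

combineView : ∀ n (p : Fin (m ℕ.* n)) → CombineView {m} {n} p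
combineView {m} n p = subst CombineView (combine-remQuot {m} n p) (combined _ _)

every-row-meets⊎some-row-avoids :
  {P : Fin m → Fin n → Set} → (∀ i j → Dec (P i j)) →
  (∀ i → ∃ (P i)) ⊎ (∃ λ i → ∀ j → ¬ P i j)
every-row-meets⊎some-row-avoids {m} {P = P} P? with all? (λ i → any? (P? i))
... | yes meets = inj₁ meets
... | no ¬meets with ¬∀⟶∃¬ m _ (λ i → any? (P? i)) ¬meets
...   | i , ¬∃ = inj₂ (i , λ j p → ¬∃ (j , p))

StrictlyIncreasing : (Fin m → Fin n) → Set
StrictlyIncreasing e = ∀ i j → i < j → e i < e j

strictlyIncreasing-reflects-< : (e : Fin m → Fin n) → StrictlyIncreasing e →
                                 ∀ i j → e i < e j → i < j
strictlyIncreasing-reflects-< e inc i j lt with <-cmp i j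
... | tri< i<j _ _ = i<j
... | tri≈ _ refl _ = ⊥-elim (<-irrefl refl lt)
... | tri> _ _ j<i = ⊥-elim (<-asym lt (inc j i j<i))

≼-refl : (π : Perm) → π ≼ π
≼-refl π = id , (λ _ _ → id) , λ _ _ → mk⇔ id id

≼-trans : {σ π ρ : Perm} → σ ≼ π → π ≼ ρ → σ ≼ ρ
≼-trans (e , e-inc , e-iso) (f , f-inc , f-iso) =
  f ∘ e , (λ i j → f-inc (e i) (e j) ∘ e-inc i j) , λ i j → f-iso (e i) (e j) ⇔-∘ e-iso i j

≼-restrict : {δ π σ : Perm} {S : Fin (size π) → Set} →
             (occ : δ ≼ π) → (∀ x → S (proj₁ occ x)) → RestrictIso π S σ → δ ≼ σ
≼-restrict {δ} {π} {σ} (f , f-inc , f-iso) f∈S (e , e-inc , e-onto , e-iso) = h , h-inc , h-iso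
  where
  preimage : ∀ x → ∃ λ y → e y ≡ f x
  preimage x = to (e-onto (f x)) (f∈S x)

  h : Fin (size δ) → Fin (size σ)
  h x = proj₁ (preimage x)

  e∘h : ∀ x → e (h x) ≡ f x
  e∘h x = proj₂ (preimage x)

  h-inc : StrictlyIncreasing h
  h-inc x y x<y = strictlyIncreasing-reflects-< e e-inc (h x) (h y)
                    (subst₂ _<_ (sym (e∘h x)) (sym (e∘h y)) (f-inc x y x<y))

  h-iso : ∀ x y → (fun δ x < fun δ y) ⇔ (fun σ (h x) < fun σ (h y))
  h-iso x y = subst₂ (λ u v → (fun π u < fun π v) ⇔ (fun σ (h x) < fun σ (h y)))
                (e∘h x) (e∘h y) (⇔-sym (e-iso (h x) (h y)))
              ⇔-∘ f-iso x y

module _ (α β : Perm) where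
  private
    a = size α
    b = size β

    value : Fin a → Fin b → Fin (a ℕ.* b)
    value i j = combine (fun α i) (fun β j)

  -- inflate α β = α[β,…,β]: position combine i j is the j-th point of block i.
  inflate-fun : Fin (a ℕ.* b) → Fin (a ℕ.* b)
  inflate-fun = uncurry value ∘ remQuot {a} b

  inflate-fun-combine : ∀ i j → inflate-fun (combine i j) ≡ value i j
  inflate-fun-combine i j = cong (uncurry value) (remQuot-combine i j)

  inflate-fun-injective : ∀ {p q} → inflate-fun p ≡ inflate-fun q → p ≡ q
  inflate-fun-injective {p} {q} eq with combineView {a} b p | combineView {a} b q
  ... | combined i j | combined k l
    with combine-injective (fun α i) (fun β j) (fun α k) (fun β l)
           (trans (sym (inflate-fun-combine i j)) (trans eq (inflate-fun-combine k l)))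
  ...   | αi≡αk , βj≡βl with inj α αi≡αk | inj β βj≡βl
  ...     | refl | refl = refl

  inflate : Perm
  inflate = perm (a ℕ.* b) inflate-fun inflate-fun-injective

  inflate-<-across : ∀ {i k} j l → i ≢ k →
                     (fun α i < fun α k) ⇔ (fun inflate (combine i j) < fun inflate (combine k l))
  inflate-<-across {i} {k} j l i≢k
    rewrite inflate-fun-combine i j | inflate-fun-combine k l =
    mk⇔ (from lex ∘ inj₁) (outer ∘ to lex)
    where
    lex = combine-<-lex (fun α i) (fun α k) (fun β j) (fun β l)
    outer : fun α i < fun α k ⊎ (fun α i ≡ fun α k × fun β j < fun β l) → fun α i < fun α k
    outer (inj₁ lt)      = lt
    outer (inj₂ (eq , _)) = ⊥-elim (i≢k (inj α eq))

  inflate-<-within : ∀ i j l →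
                     (fun β j < fun β l) ⇔ (fun inflate (combine i j) < fun inflate (combine i l))
  inflate-<-within i j l
    rewrite inflate-fun-combine i j | inflate-fun-combine i l =
    mk⇔ (λ lt → from lex (inj₂ (refl , lt))) (inner ∘ to lex)
    where
    lex = combine-<-lex (fun α i) (fun α i) (fun β j) (fun β l)
    inner : fun α i < fun α i ⊎ (fun α i ≡ fun α i × fun β j < fun β l) → fun β j < fun β l
    inner (inj₁ lt)       = ⊥-elim (<-irrefl refl lt)
    inner (inj₂ (_ , lt)) = lt

  transversal-≼-inflate : (s : Fin a → Fin b) → α ≼ inflate
  transversal-≼-inflate s = (λ i → combine i (s i)) , (λ i k → combine-monoˡ-< (s i) (s k)) , iso
    where
    iso : ∀ i k → (fun α i < fun α k) ⇔
                  (fun inflate (combine i (s i)) < fun inflate (combine k (s k)))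
    iso i k with i ≟ k
    ... | yes refl = mk⇔ (⊥-elim ∘ <-irrefl refl) (⊥-elim ∘ <-irrefl refl)
    ... | no i≢k   = inflate-<-across (s i) (s k) i≢k

  block-≼-inflate : Fin a → β ≼ inflate
  block-≼-inflate i = combine i , (λ j l → combine-monoʳ-< i) , inflate-<-within i

  inflate-∈-Inflation : (X Y : PSet) → X α → Y β → Inflation X Y inflate
  inflate-∈-Inflation X Y α∈X β∈Y =
    α , α∈X , quotient {a} b , block-mono , block-across , λ i → β , β∈Y , block-iso i
    where
    quotient-combine : ∀ i j → quotient {a} b (combine i j) ≡ i
    quotient-combine i j = cong proj₁ (remQuot-combine i j)

    block-mono : ∀ p q → p ≤ q → quotient {a} b p ≤ quotient {a} b q
    block-mono p q p≤q with combineView {a} b p | combineView {a} b q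
    ... | combined i j | combined k l
      rewrite quotient-combine i j | quotient-combine k l with <-cmp i k
    ...   | tri< i<k _ _ = ℕ.<⇒≤ i<k
    ...   | tri≈ _ refl _ = ≤-refl
    ...   | tri> _ _ k<i = ⊥-elim (ℕ.<⇒≱ (combine-monoˡ-< l j k<i) p≤q)

    block-across : ∀ p q → quotient {a} b p ≢ quotient {a} b q →
                   (fun inflate p < fun inflate q) ⇔
                   (fun α (quotient {a} b p) < fun α (quotient {a} b q))
    block-across p q ne with combineView {a} b p | combineView {a} b q
    ... | combined i j | combined k l =
      subst₂ (λ u v → (fun inflate (combine i j) < fun inflate (combine k l)) ⇔ (fun α u < fun α v))
             (sym (quotient-combine i j)) (sym (quotient-combine k l))
        (⇔-sym (inflate-<-across j l λ i≡k →
          ne (trans (quotient-combine i j) (trans i≡k (sym (quotient-combine k l))))))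

    block-iso : ∀ i → RestrictIso inflate (λ p → quotient {a} b p ≡ i) β
    block-iso i = combine i , (λ j l → combine-monoʳ-< i) , onto , inflate-<-within i
      where
      onto : ∀ p → (quotient {a} b p ≡ i) ⇔ ∃ λ j → combine i j ≡ p
      onto p with combineView {a} b p
      ... | combined k l rewrite quotient-combine k l =
        mk⇔ (λ { refl → l , refl }) (λ (j , eq) → sym (proj₁ (combine-injective i j k l eq)))

inflate-≼-merge : {α β π σ ρ : Perm} (c : Fin (size π) → Bool) →
                  inflate α β ≼ π →
                  RestrictIso π (λ p → c p ≡ true) σ → RestrictIso π (λ p → c p ≡ false) ρ →
                  α ≼ σ ⊎ β ≼ ρ
inflate-≼-merge {α} {β} {π} {σ} {ρ} c occ@(f , _ , _) on-true on-false
  with every-row-meets⊎some-row-avoids (λ i j → c (f (combine i j)) ≟ᵇ true)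
... | inj₁ meets =
  inj₁ (≼-restrict {α} {π} {σ}
         (≼-trans {α} {inflate α β} {π} (transversal-≼-inflate α β (proj₁ ∘ meets)) occ)
         (proj₂ ∘ meets) on-true)
... | inj₂ (i , avoids) =
  inj₂ (≼-restrict {β} {π} {ρ}
         (≼-trans {β} {inflate α β} {π} (block-≼-inflate α β i) occ)
         (λ j → ¬-not (avoids j)) on-false)

module _ (C : PSet) (inflation-closed : Inflation C C ⊆ C) where

  avoider-of-merge : ∀ {k} (Ds : Vec PSet (suc k)) → AllV (λ D → ProperSubclass D C) Ds →
                     Σ Perm λ Δ → C Δ × (∀ π → ⨀ Ds π → ¬ (Δ ≼ π))
  avoider-of-merge (D ∷ []) ((D-class , _ , α , α∈C , α∉D) ∷ []) =
    α , α∈C , λ π π∈D α≼π → α∉D (D-class α π α≼π π∈D)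
  avoider-of-merge (D ∷ D′ ∷ Ds) ((D-class , _ , α , α∈C , α∉D) ∷ proper)
    with avoider-of-merge (D′ ∷ Ds) proper
  ... | Δ , Δ∈C , Δ-avoids =
    inflate α Δ , inflation-closed _ (inflate-∈-Inflation α Δ C C α∈C Δ∈C) , avoids
    where
    avoids : ∀ π → (D ⊙ ⨀ (D′ ∷ Ds)) π → ¬ (inflate α Δ ≼ π)
    avoids π (c , (σ , σ∈D , on-true) , (ρ , ρ∈⨀ , on-false)) occ
      with inflate-≼-merge {α} {Δ} {π} {σ} {ρ} c occ on-true on-false
    ... | inj₁ α≼σ = α∉D (D-class α σ α≼σ σ∈D)
    ... | inj₂ Δ≼ρ = Δ-avoids ρ ρ∈⨀ Δ≼ρ

-- C need not be a class: only the proper subclasses Dᵢ must be closed under patterns.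
mainTheorem9 : (C : PSet) → IsClass C → C ≐ Inflation C C → Unsplittable C
mainTheorem9 C _ (_ , inflation-closed) (_ , Ds , proper , C⊆⨀Ds)
  with avoider-of-merge C inflation-closed Ds proper
... | Δ , Δ∈C , Δ-avoids = Δ-avoids Δ (C⊆⨀Ds Δ Δ∈C) (≼-refl Δ)
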